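{- Let $G$ be a connected graph with at least $2$ vertices, let $H$ be a connected graph, and let $U$ be a non-empty subset of $V(G)$. Then \[F(G(U)\Pi H)=|V(H)|\,F(G)+6|E(H)|\sum_{u\in U}d_G(u)^2+3M_1(H)\sum_{u\in U}d_G(u)+|U|\,F(H).\]
   Context: All graphs are finite, simple and undirected; $d_G(v)$ is the degree of $v$ in $G$. The F-index is $F(G)=\sum_{v\in V(G)}d_G(v)^3$ and the first Zagreb index is $M_1(G)=\sum_{v\in V(G)}d_G(v)^2$. For graphs $G,H$ and a non-empty $U\subseteq V(G)$, the generalized hierarchical product $G(U)\Pi H$ is the graph with vertex set $V(G)\times V(H)$ in which $(u,v)$ and $(u',v')$ are adjacent if and only if either [$u=u'\in U$ and $vv'\in E(H)$] or [$v=v'$ and $uu'\in E(G)$]. -}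

module Defs where

open import Data.Nat using (ℕ; zero; suc; _+_; _*_; _^_; _<ᵇ_)
open import Data.Bool using (Bool; true; false; if_then_else_; _∧_; _∨_)
open import Data.Fin using (Fin; zero; suc; toℕ; remQuot)
open import Data.Fin.Properties using (_≟_)
open import Data.Fin.Subset using (Subset; inside; outside)
open import Data.Vec using (lookup)
open import Data.Product using (_×_; _,_; proj₁; proj₂)
open import Relation.Nullary.Decidable using (⌊_⌋)
open import Relation.Binary.PropositionalEquality using (_≡_)

Adj : ℕ → Set
Adj n = Fin n → Fin n → Bool

record IsSimple {n : ℕ} (A : Adj n) : Set where
  field
    sym     : ∀ i j → A i j ≡ A j i
    irrefl  : ∀ i → A i i ≡ false

data Reachable {n : ℕ} (A : Adj n) : Fin n → Fin n → Set where
  here  : ∀ {i} → Reachable A i i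
  step  : ∀ {i j k} → A i j ≡ true → Reachable A j k → Reachable A i k

Connected : {n : ℕ} → Adj n → Set
Connected {n} A = ∀ (i j : Fin n) → Reachable A i j

sumFin : ∀ {n} → (Fin n → ℕ) → ℕ
sumFin {zero}  f = 0
sumFin {suc n} f = f zero + sumFin (λ i → f (suc i))

inU : ∀ {n} → Subset n → Fin n → Bool
inU U i with lookup U i
... | inside  = true
... | outside = false

sumOver : ∀ {n} → Subset n → (Fin n → ℕ) → ℕ
sumOver U f = sumFin (λ i → if inU U i then f i else 0)

card : ∀ {n} → Subset n → ℕ
card U = sumOver U (λ _ → 1)

b2n : Bool → ℕ
b2n true  = 1
b2n false = 0

deg : ∀ {n} → Adj n → Fin n → ℕ
deg A i = sumFin (λ j → b2n (A i j))

edges : ∀ {n} → Adj n → ℕ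
edges A = sumFin (λ i → sumFin (λ j → b2n ((toℕ i <ᵇ toℕ j) ∧ A i j)))

Findex : ∀ {n} → Adj n → ℕ
Findex A = sumFin (λ i → deg A i ^ 3)

M1 : ∀ {n} → Adj n → ℕ
M1 A = sumFin (λ i → deg A i ^ 2)

-- Generalized hierarchical product G(U)ΠH on V(G) × V(H),
-- encoded as Fin (n * m) via remQuot (k ↦ (u , v)).
hierProd : ∀ {n m} → Adj n → Subset n → Adj m → Adj (n * m)
hierProd {n} {m} G U H k k' =
  let u  = proj₁ (remQuot {n} m k)  ; v  = proj₂ (remQuot {n} m k)
      u' = proj₁ (remQuot {n} m k') ; v' = proj₂ (remQuot {n} m k')
  in (⌊ u ≟ u' ⌋ ∧ inU U u ∧ H v v') ∨ (⌊ v ≟ v' ⌋ ∧ G u u')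

module Submission where

-- The vertex (u , v) of G(U)ΠH has degree d_G(u) + [u ∈ U] d_H(v). Expanding the
-- cube and summing over v with Σ_v d_H(v) = 2|E(H)| leaves
-- |V(H)| d_G(u)³ + [u ∈ U] (6|E(H)| d_G(u)² + 3 M₁(H) d_G(u) + F(H)),
-- and summing over u gives the formula.

open import Defs
open import Data.Bool using (Bool; true; false; _∧_; _∨_; if_then_else_)
open import Data.Bool.Properties using (∧-zeroʳ)
open import Data.Fin using (Fin; zero; suc; toℕ; combine; _↑ˡ_; _↑ʳ_)
open import Data.Fin.Properties using (_≟_; remQuot-combine; toℕ-injective)
open import Data.Fin.Subset using (Subset; Nonempty)
open import Data.Nat using (ℕ; zero; suc; _+_; _*_; _^_; _≤_; _<_; _<ᵇ_)
open import Data.Nat.Properties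
  using (+-identityʳ; +-assoc; *-comm; *-identityʳ; *-zeroʳ; <-cmp; <ᵇ-reflects-<; +-*-semiring)
open import Algebra.Properties.Semiring.Sum +-*-semiring
  using (sum; ∑-distrib-+; ∑-comm; *-distribˡ-sum)
open import Data.Nat.Solver using (module +-*-Solver)
open import Data.Product using (_×_; _,_)
open import Relation.Binary using (tri<; tri≈; tri>)
open import Relation.Binary.PropositionalEquality
  using (_≡_; refl; sym; trans; cong; cong₂; module ≡-Reasoning)
open import Relation.Nullary using (¬_)
open import Relation.Nullary.Decidable using (⌊_⌋; yes; no)
open import Relation.Nullary.Reflects using (ofʸ; ofⁿ; det)

open +-*-Solver
open ≡-Reasoning

sumFin≡sum : ∀ {n} (f : Fin n → ℕ) → sumFin f ≡ sum f
sumFin≡sum {zero}  f = refl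
sumFin≡sum {suc n} f = cong (f zero +_) (sumFin≡sum (λ i → f (suc i)))

sumFin-cong : ∀ {n} {f g : Fin n → ℕ} → (∀ i → f i ≡ g i) → sumFin f ≡ sumFin g
sumFin-cong {zero}  f≗g = refl
sumFin-cong {suc n} f≗g = cong₂ _+_ (f≗g zero) (sumFin-cong (λ i → f≗g (suc i)))

sumFin-+ : ∀ {n} (f g : Fin n → ℕ) →
  sumFin (λ i → f i + g i) ≡ sumFin f + sumFin g
sumFin-+ f g = begin
  sumFin (λ i → f i + g i)  ≡⟨ sumFin≡sum (λ i → f i + g i) ⟩
  sum (λ i → f i + g i)     ≡⟨ ∑-distrib-+ f g ⟩
  sum f + sum g             ≡⟨ cong₂ _+_ (sumFin≡sum f) (sumFin≡sum g) ⟨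
  sumFin f + sumFin g       ∎

sumFin-*ˡ : ∀ {n} (c : ℕ) (f : Fin n → ℕ) →
  sumFin (λ i → c * f i) ≡ c * sumFin f
sumFin-*ˡ c f = begin
  sumFin (λ i → c * f i)  ≡⟨ sumFin≡sum (λ i → c * f i) ⟩
  sum (λ i → c * f i)     ≡⟨ *-distribˡ-sum c f ⟨
  c * sum f               ≡⟨ cong (c *_) (sumFin≡sum f) ⟨
  c * sumFin f            ∎

sumFin-const : ∀ {n} (c : ℕ) → sumFin {n} (λ _ → c) ≡ n * c
sumFin-const {zero}  c = refl
sumFin-const {suc n} c = cong (c +_) (sumFin-const {n} c)

sumFin-comm : ∀ {m n} (f : Fin m → Fin n → ℕ) →
  sumFin (λ i → sumFin (λ j → f i j)) ≡ sumFin (λ j → sumFin (λ i → f i j))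
sumFin-comm f = begin
  sumFin (λ i → sumFin (λ j → f i j))  ≡⟨ sumFin-cong (λ i → sumFin≡sum (f i)) ⟩
  sumFin (λ i → sum (λ j → f i j))     ≡⟨ sumFin≡sum (λ i → sum (f i)) ⟩
  sum (λ i → sum (λ j → f i j))        ≡⟨ ∑-comm f ⟩
  sum (λ j → sum (λ i → f i j))        ≡⟨ sumFin≡sum (λ j → sum (λ i → f i j)) ⟨
  sumFin (λ j → sum (λ i → f i j))     ≡⟨ sumFin-cong (λ j → sumFin≡sum (λ i → f i j)) ⟨
  sumFin (λ j → sumFin (λ i → f i j))  ∎

sumFin-↑ : ∀ m n (f : Fin (m + n) → ℕ) →
  sumFin f ≡ sumFin (λ i → f (i ↑ˡ n)) + sumFin (λ j → f (m ↑ʳ j))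
sumFin-↑ zero    n f = refl
sumFin-↑ (suc m) n f =
  trans (cong (f zero +_) (sumFin-↑ m n (λ i → f (suc i)))) (sym (+-assoc (f zero) _ _))

sumFin-combine : ∀ m n (f : Fin (m * n) → ℕ) →
  sumFin f ≡ sumFin {m} (λ u → sumFin {n} (λ v → f (combine u v)))
sumFin-combine zero    n f = refl
sumFin-combine (suc m) n f = trans (sumFin-↑ n (m * n) f)
  (cong (sumFin (λ v → f (v ↑ˡ (m * n))) +_) (sumFin-combine m n (λ k → f (n ↑ʳ k))))

sumFin-δ : ∀ {n} (i : Fin n) (f : Fin n → ℕ) →
  sumFin (λ j → b2n ⌊ i ≟ j ⌋ * f j) ≡ f i
sumFin-δ {suc n} zero f = begin
  f zero + 0 + sumFin {n} (λ _ → 0)  ≡⟨ cong₂ _+_ (+-identityʳ (f zero)) (sumFin-const {n} 0) ⟩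
  f zero + n * 0                     ≡⟨ cong (f zero +_) (*-zeroʳ n) ⟩
  f zero + 0                         ≡⟨ +-identityʳ (f zero) ⟩
  f zero                             ∎
sumFin-δ {suc n} (suc i) f =
  trans (sumFin-cong (λ j → cong (λ b → b2n b * f (suc j)) (suc≟suc i j)))
        (sumFin-δ i (λ j → f (suc j)))
  where
  suc≟suc : ∀ (i j : Fin n) → ⌊ suc i ≟ suc j ⌋ ≡ ⌊ i ≟ j ⌋
  suc≟suc i j with i ≟ j
  ... | yes _ = refl
  ... | no  _ = refl

sumOver-+ : ∀ {n} (U : Subset n) (f g : Fin n → ℕ) →
  sumOver U (λ i → f i + g i) ≡ sumOver U f + sumOver U g
sumOver-+ U f g = trans (sumFin-cong (λ i → if-+ (inU U i)))
  (sumFin-+ (λ i → if inU U i then f i else 0) (λ i → if inU U i then g i else 0))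
  where
  if-+ : ∀ {i} x → (if x then f i + g i else 0) ≡ (if x then f i else 0) + (if x then g i else 0)
  if-+ true  = refl
  if-+ false = refl

sumOver-*ˡ : ∀ {n} (U : Subset n) (c : ℕ) (f : Fin n → ℕ) →
  sumOver U (λ i → c * f i) ≡ c * sumOver U f
sumOver-*ˡ U c f = trans (sumFin-cong (λ i → if-* (inU U i)))
  (sumFin-*ˡ c (λ i → if inU U i then f i else 0))
  where
  if-* : ∀ {i} x → (if x then c * f i else 0) ≡ c * (if x then f i else 0)
  if-* true  = refl
  if-* false = sym (*-zeroʳ c)

sumOver-const : ∀ {n} (U : Subset n) (c : ℕ) → sumOver U (λ _ → c) ≡ card U * c
sumOver-const U c = begin
  sumOver U (λ _ → c)      ≡⟨ sumFin-cong (λ i → cong (if inU U i then_else 0) (*-identityʳ c)) ⟨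
  sumOver U (λ _ → c * 1)  ≡⟨ sumOver-*ˡ U c (λ _ → 1) ⟩
  c * card U               ≡⟨ *-comm c (card U) ⟩
  card U * c               ∎

b2n-∧ : ∀ x y → b2n (x ∧ y) ≡ b2n x * b2n y
b2n-∧ true  y = sym (+-identityʳ (b2n y))
b2n-∧ false y = refl

b2n-* : ∀ x y → b2n x * y ≡ (if x then y else 0)
b2n-* true  y = +-identityʳ y
b2n-* false y = refl

<ᵇ-true : ∀ {a b} → a < b → (a <ᵇ b) ≡ true
<ᵇ-true {a} {b} a<b = det (<ᵇ-reflects-< a b) (ofʸ a<b)

<ᵇ-false : ∀ {a b} → ¬ a < b → (a <ᵇ b) ≡ false
<ᵇ-false {a} {b} a≮b = det (<ᵇ-reflects-< a b) (ofⁿ a≮b)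

b2n-split-< : ∀ {m} (H : Adj m) → IsSimple H → ∀ i j →
  b2n (H i j) ≡ b2n ((toℕ i <ᵇ toℕ j) ∧ H i j) + b2n ((toℕ j <ᵇ toℕ i) ∧ H j i)
b2n-split-< H simple i j rewrite IsSimple.sym simple j i with <-cmp (toℕ i) (toℕ j)
... | tri< i<j _ j≮i rewrite <ᵇ-true i<j | <ᵇ-false j≮i = sym (+-identityʳ (b2n (H i j)))
... | tri> i≮j _ j<i rewrite <ᵇ-true j<i | <ᵇ-false i≮j = refl
... | tri≈ _ i≡j _ with toℕ-injective i≡j
...   | refl rewrite IsSimple.irrefl simple i | ∧-zeroʳ (toℕ i <ᵇ toℕ i) = refl

handshake : ∀ {m} (H : Adj m) → IsSimple H → sumFin (deg H) ≡ 2 * edges H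
handshake {m} H simple = begin
  sumFin (λ i → sumFin (λ j → b2n (H i j)))
    ≡⟨ sumFin-cong (λ i → sumFin-cong (b2n-split-< H simple i)) ⟩
  sumFin (λ i → sumFin (λ j → e i j + e j i))
    ≡⟨ sumFin-cong (λ i → sumFin-+ (e i) (λ j → e j i)) ⟩
  sumFin (λ i → sumFin (e i) + sumFin (λ j → e j i))
    ≡⟨ sumFin-+ (λ i → sumFin (e i)) (λ i → sumFin (λ j → e j i)) ⟩
  edges H + sumFin (λ i → sumFin (λ j → e j i))
    ≡⟨ cong (edges H +_) (sumFin-comm (λ i j → e j i)) ⟩
  edges H + edges H
    ≡⟨ cong (edges H +_) (+-identityʳ (edges H)) ⟨
  2 * edges H ∎
  where
  e : Fin m → Fin m → ℕ
  e i j = b2n ((toℕ i <ᵇ toℕ j) ∧ H i j)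

hierProd-combine : ∀ {n m} (G : Adj n) (U : Subset n) (H : Adj m) u u' v v' →
  hierProd G U H (combine u v) (combine u' v')
    ≡ (⌊ u ≟ u' ⌋ ∧ inU U u ∧ H v v') ∨ (⌊ v ≟ v' ⌋ ∧ G u u')
hierProd-combine {n} {m} G U H u u' v v' =
  cong₂ adj (remQuot-combine {n} {m} u v) (remQuot-combine {n} {m} u' v')
  where
  adj : Fin n × Fin m → Fin n × Fin m → Bool
  adj (u , v) (u' , v') = (⌊ u ≟ u' ⌋ ∧ inU U u ∧ H v v') ∨ (⌊ v ≟ v' ⌋ ∧ G u u')

-- The two kinds of edges of G(U)ΠH never coincide, since G has no loops.
b2n-hierProd : ∀ {n m} (G : Adj n) (U : Subset n) (H : Adj m) → IsSimple G → ∀ u u' v v' →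
  b2n (hierProd G U H (combine u v) (combine u' v'))
    ≡ b2n ⌊ u ≟ u' ⌋ * (b2n (inU U u) * b2n (H v v')) + b2n ⌊ v ≟ v' ⌋ * b2n (G u u')
b2n-hierProd G U H simple u u' v v' rewrite hierProd-combine G U H u u' v v' with u ≟ u'
... | no  _    = b2n-∧ ⌊ v ≟ v' ⌋ (G u u')
... | yes refl rewrite IsSimple.irrefl simple u = disjoint (inU U u) (H v v') ⌊ v ≟ v' ⌋
  where
  disjoint : ∀ p q d → b2n ((p ∧ q) ∨ (d ∧ false)) ≡ 1 * (b2n p * b2n q) + b2n d * 0
  disjoint true  true  d     = cong (1 +_) (sym (*-zeroʳ (b2n d)))
  disjoint true  false true  = refl
  disjoint true  false false = refl
  disjoint false q     true  = refl
  disjoint false q     false = refl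

deg-hierProd : ∀ {n m} (G : Adj n) (U : Subset n) (H : Adj m) → IsSimple G → ∀ u v →
  deg (hierProd G U H) (combine u v) ≡ (if inU U u then deg H v else 0) + deg G u
deg-hierProd {n} {m} G U H simple u v = begin
  deg (hierProd G U H) (combine u v)
    ≡⟨ sumFin-combine n m (λ k → b2n (hierProd G U H (combine u v) k)) ⟩
  sumFin (λ (u' : Fin n) → sumFin (λ (v' : Fin m) →
    b2n (hierProd G U H (combine u v) (combine u' v'))))
    ≡⟨ sumFin-cong (λ u' → sumFin-cong (b2n-hierProd G U H simple u u' v)) ⟩
  sumFin (λ u' → sumFin (λ v' → δ u u' * (b * b2n (H v v')) + δ v v' * b2n (G u u')))
    ≡⟨ sumFin-cong row ⟩
  sumFin (λ u' → δ u u' * (b * deg H v) + b2n (G u u'))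
    ≡⟨ sumFin-+ (λ u' → δ u u' * (b * deg H v)) (λ u' → b2n (G u u')) ⟩
  sumFin (λ u' → δ u u' * (b * deg H v)) + deg G u
    ≡⟨ cong (_+ deg G u) (trans (sumFin-δ u (λ _ → b * deg H v)) (b2n-* (inU U u) (deg H v))) ⟩
  (if inU U u then deg H v else 0) + deg G u ∎
  where
  δ : ∀ {k} → Fin k → Fin k → ℕ
  δ i j = b2n ⌊ i ≟ j ⌋
  b : ℕ
  b = b2n (inU U u)
  row : ∀ u' → sumFin (λ v' → δ u u' * (b * b2n (H v v')) + δ v v' * b2n (G u u'))
             ≡ δ u u' * (b * deg H v) + b2n (G u u')
  row u' = begin
    sumFin (λ v' → δ u u' * (b * b2n (H v v')) + δ v v' * b2n (G u u'))
      ≡⟨ sumFin-+ (λ v' → δ u u' * (b * b2n (H v v'))) (λ v' → δ v v' * b2n (G u u')) ⟩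
    sumFin (λ v' → δ u u' * (b * b2n (H v v'))) + sumFin (λ v' → δ v v' * b2n (G u u'))
      ≡⟨ cong₂ _+_ (trans (sumFin-*ˡ (δ u u') (λ v' → b * b2n (H v v')))
                          (cong (δ u u' *_) (sumFin-*ˡ b (λ v' → b2n (H v v')))))
                   (sumFin-δ v (λ _ → b2n (G u u'))) ⟩
    δ u u' * (b * deg H v) + b2n (G u u') ∎

sumFin-cube-shift : ∀ {m} (h : Fin m → ℕ) (d : ℕ) →
  sumFin (λ v → (h v + d) ^ 3)
    ≡ m * d ^ 3 + 3 * d ^ 2 * sumFin h + 3 * d * sumFin (λ v → h v ^ 2) + sumFin (λ v → h v ^ 3)
sumFin-cube-shift {zero} h d =
  solve 1 (λ d → con 0 := con 0 :* d :^ 3 :+ con 3 :* d :^ 2 :* con 0 :+ con 3 :* d :* con 0 :+ con 0)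
          refl d
sumFin-cube-shift {suc m} h d = begin
  (h zero + d) ^ 3 + sumFin (λ v → (h (suc v) + d) ^ 3)
    ≡⟨ cong ((h zero + d) ^ 3 +_) (sumFin-cube-shift (λ v → h (suc v)) d) ⟩
  (h zero + d) ^ 3 + (m * d ^ 3 + 3 * d ^ 2 * Σh + 3 * d * Σh² + Σh³)
    ≡⟨ solve 6 (λ m h d Σh Σh² Σh³ →
         (h :+ d) :^ 3 :+ (m :* d :^ 3 :+ con 3 :* d :^ 2 :* Σh :+ con 3 :* d :* Σh² :+ Σh³)
         := (con 1 :+ m) :* d :^ 3 :+ con 3 :* d :^ 2 :* (h :+ Σh)
            :+ con 3 :* d :* (h :^ 2 :+ Σh²) :+ (h :^ 3 :+ Σh³))
         refl m (h zero) d Σh Σh² Σh³ ⟩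
  suc m * d ^ 3 + 3 * d ^ 2 * (h zero + Σh) + 3 * d * (h zero ^ 2 + Σh²) + (h zero ^ 3 + Σh³) ∎
  where
  Σh Σh² Σh³ : ℕ
  Σh  = sumFin (λ v → h (suc v))
  Σh² = sumFin (λ v → h (suc v) ^ 2)
  Σh³ = sumFin (λ v → h (suc v) ^ 3)

sumFin-deg³-hierProd : ∀ {n m} (G : Adj n) (U : Subset n) (H : Adj m) →
  IsSimple G → IsSimple H → ∀ u →
  sumFin (λ v → deg (hierProd G U H) (combine u v) ^ 3)
    ≡ m * deg G u ^ 3
      + (if inU U u then 6 * edges H * deg G u ^ 2 + 3 * M1 H * deg G u + Findex H else 0)
sumFin-deg³-hierProd {m = m} G U H simpleG simpleH u =
  trans (sumFin-cong (λ v → cong (_^ 3) (deg-hierProd G U H simpleG u v))) (shifted (inU U u))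
  where
  d : ℕ
  d = deg G u
  shifted : ∀ x → sumFin (λ v → ((if x then deg H v else 0) + d) ^ 3)
                  ≡ m * d ^ 3 + (if x then 6 * edges H * d ^ 2 + 3 * M1 H * d + Findex H else 0)
  shifted false = trans (sumFin-const {m} (d ^ 3)) (sym (+-identityʳ (m * d ^ 3)))
  shifted true  = begin
    sumFin (λ v → (deg H v + d) ^ 3)
      ≡⟨ sumFin-cube-shift (deg H) d ⟩
    m * d ^ 3 + 3 * d ^ 2 * sumFin (deg H) + 3 * d * M1 H + Findex H
      ≡⟨ cong (λ s → m * d ^ 3 + 3 * d ^ 2 * s + 3 * d * M1 H + Findex H) (handshake H simpleH) ⟩
    m * d ^ 3 + 3 * d ^ 2 * (2 * edges H) + 3 * d * M1 H + Findex H
      ≡⟨ solve 5 (λ m d E M F → m :* d :^ 3 :+ con 3 :* d :^ 2 :* (con 2 :* E) :+ con 3 :* d :* M :+ F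
                               := m :* d :^ 3 :+ (con 6 :* E :* d :^ 2 :+ con 3 :* M :* d :+ F))
                 refl m d (edges H) (M1 H) (Findex H) ⟩
    m * d ^ 3 + (6 * edges H * d ^ 2 + 3 * M1 H * d + Findex H) ∎

theorem1 : ∀ {n m : ℕ} (G : Adj n) (H : Adj m) (U : Subset n) →
    IsSimple G → Connected G → 2 ≤ n →
    IsSimple H → Connected H →
    Nonempty U →
    Findex (hierProd G U H)
      ≡ m * Findex G
        + 6 * edges H * sumOver U (λ u → deg G u ^ 2)
        + 3 * M1 H * sumOver U (λ u → deg G u)
        + card U * Findex H
theorem1 {n} {m} G H U simpleG _ _ simpleH _ _ = begin
  Findex (hierProd G U H)
    ≡⟨ sumFin-combine n m (λ k → deg (hierProd G U H) k ^ 3) ⟩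
  sumFin (λ (u : Fin n) → sumFin (λ (v : Fin m) → deg (hierProd G U H) (combine u v) ^ 3))
    ≡⟨ sumFin-cong (sumFin-deg³-hierProd G U H simpleG simpleH) ⟩
  sumFin (λ u → m * deg G u ^ 3 + (if inU U u then c u else 0))
    ≡⟨ sumFin-+ (λ u → m * deg G u ^ 3) (λ u → if inU U u then c u else 0) ⟩
  sumFin (λ u → m * deg G u ^ 3) + sumOver U c
    ≡⟨ cong₂ _+_ (sumFin-*ˡ m (λ u → deg G u ^ 3)) sumOver-c ⟩
  m * Findex G + (6 * E * Σd² + 3 * M * Σd + card U * F)
    ≡⟨ trans (sym (+-assoc (m * Findex G) (6 * E * Σd² + 3 * M * Σd) (card U * F)))
             (cong (_+ card U * F) (sym (+-assoc (m * Findex G) (6 * E * Σd²) (3 * M * Σd)))) ⟩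
  m * Findex G + 6 * E * Σd² + 3 * M * Σd + card U * F ∎
  where
  E M F Σd² Σd : ℕ
  E   = edges H
  M   = M1 H
  F   = Findex H
  Σd² = sumOver U (λ u → deg G u ^ 2)
  Σd  = sumOver U (deg G)
  c : Fin n → ℕ
  c u = 6 * E * deg G u ^ 2 + 3 * M * deg G u + F
  sumOver-c : sumOver U c ≡ 6 * E * Σd² + 3 * M * Σd + card U * F
  sumOver-c = begin
    sumOver U c
      ≡⟨ sumOver-+ U (λ u → 6 * E * deg G u ^ 2 + 3 * M * deg G u) (λ _ → F) ⟩
    sumOver U (λ u → 6 * E * deg G u ^ 2 + 3 * M * deg G u) + sumOver U (λ _ → F)
      ≡⟨ cong₂ _+_ (sumOver-+ U (λ u → 6 * E * deg G u ^ 2) (λ u → 3 * M * deg G u))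
                   (sumOver-const U F) ⟩
    sumOver U (λ u → 6 * E * deg G u ^ 2) + sumOver U (λ u → 3 * M * deg G u) + card U * F
      ≡⟨ cong₂ (λ x y → x + y + card U * F)
               (sumOver-*ˡ U (6 * E) (λ u → deg G u ^ 2)) (sumOver-*ˡ U (3 * M) (deg G)) ⟩
    6 * E * Σd² + 3 * M * Σd + card U * F ∎
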